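{- Let $X$ be a finite pure $d$-dimensional simplicial complex which is an $\epsilon$-colorful expander. Then for every $0\le i<d$ the conductance of the $i$-graph satisfies $$\Phi(G_i(X))\ge\frac{\epsilon}{i+2}.$$
   Context: A simplicial complex $X$ on a finite vertex set is a family of subsets (faces) closed under taking subsets. A face $\sigma$ has dimension $|\sigma|-1$; $X(i)$ is the set of $i$-faces. $X$ is $d$-dimensional if its maximal face dimension is $d$, pure if every face lies in a $d$-face. $\deg(\sigma)$ is the number of $d$-faces containing $\sigma$. For $W\subseteq X(i)$, $\|W\|=\sum_{\sigma\in W}\deg(\sigma)/\sum_{\tau\in X(i)}\deg(\tau)$. For $W\subseteq X(i)$, $0\le i<d$, $\psi(W)=\{\tau\in X(i+1):\exists\,\sigma,\sigma'\subset\tau,\ \sigma\in W,\ \sigma'\in X(i)\setminus W\}$. $X$ is an $\epsilon$-colorful expander ($\epsilon>0$) if for every $0\le i<d$ and every $W\subseteq X(i)$ with $0<\|W\|\le1/2$, $\|\psi(W)\|/\|W\|\ge\epsilon$. The $i$-graph $G_i(X)$ is the multigraph with vertex set $X(i)$ having, for each pair of distinct $\sigma,\sigma'\in X(i)$ with $\sigma\cup\sigma'\in X(i+1)$, exactly $\deg(\sigma\cup\sigma')$ parallel edges between $\sigma$ and $\sigma'$. For a multigraph $G=(V,E)$, $\deg(v)$ is the number of edges at $v$, $\mathrm{vol}(S)=\sum_{v\in S}\deg(v)$, $E(S,\bar S)$ is the multiset of edges with exactly one endpoint in $S$, $\Phi(S)=|E(S,\bar S)|/\mathrm{vol}(S)$,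 and the conductance is $\Phi(G)=\min\{\Phi(S):\emptyset\ne S\subseteq V,\ \mathrm{vol}(S)\le\mathrm{vol}(V)/2\}$. -}

module Defs where

open import Function using (_∘_)
open import Data.Nat as ℕ using (ℕ; zero; suc; _+_; _*_)
open import Data.Bool using (Bool; true; false; T; _∧_; not; if_then_else_)
import Data.Bool.Properties as BoolP
open import Data.Vec using ([]; _∷_)
open import Data.Vec.Properties using (≡-dec)
open import Data.List using (List; []; _∷_; filterᵇ; map; length; _++_)
open import Data.Nat.ListAction using (sum)
open import Data.Bool.ListAction using (any)
open import Data.List.Membership.Propositional using (_∈_)
open import Data.Fin.Subset using (Subset; _⊆_; _∪_; ∣_∣; inside; outside)
open import Data.Fin.Subset.Properties using (_⊆?_)
open import Data.Integer using (+_)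
open import Data.Rational as ℚ using (ℚ; 0ℚ; ½; _/_; _÷_; >-nonZero)
open import Data.Product using (Σ; ∃; _×_)
open import Relation.Nullary.Decidable using (does)

allSubsets : (n : ℕ) → List (Subset n)
allSubsets zero    = [] ∷ []
allSubsets (suc n) = map (outside ∷_) (allSubsets n) ++ map (inside ∷_) (allSubsets n)

sumOver : {A : Set} → List A → (A → ℕ) → ℕ
sumOver xs f = sum (map f xs)

-- the rational a / b (convention: 0 when b = 0; never used with b = 0
-- in the situations of the theorem)
frac : ℕ → ℕ → ℚ
frac a zero    = 0ℚ
frac a (suc b) = (+ a) / suc b

_≟S_ : {n : ℕ} → (σ τ : Subset n) → Bool
σ ≟S τ = does (≡-dec BoolP._≟_ σ τ)

record SimplicialComplex (n : ℕ) : Set where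
  field
    face        : Subset n → Bool
    down-closed : ∀ {σ τ} → σ ⊆ τ → T (face τ) → T (face σ)

module _ {n : ℕ} (X : SimplicialComplex n) where
  open SimplicialComplex X

  isFaceOfDim : ℕ → Subset n → Bool
  isFaceOfDim i σ = face σ ∧ does (∣ σ ∣ ℕ.≟ suc i)

  faces : ℕ → List (Subset n)
  faces i = filterᵇ (isFaceOfDim i) (allSubsets n)

  IsDimension : ℕ → Set
  IsDimension d = (∃ λ σ → T (isFaceOfDim d σ))
                × (∀ σ → T (face σ) → ∣ σ ∣ ℕ.≤ suc d)

  IsPure : ℕ → Set
  IsPure d = ∀ σ → T (face σ) → ∃ λ τ → T (isFaceOfDim d τ) × σ ⊆ τ

  deg : ℕ → Subset n → ℕ
  deg d σ = length (filterᵇ (λ τ → isFaceOfDim d τ ∧ does (σ ⊆? τ)) (allSubsets n))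

  norm : ℕ → ℕ → (Subset n → Bool) → ℚ
  norm d i W = frac (sumOver (filterᵇ W (faces i)) (deg d))
                    (sumOver (faces i) (deg d))

  ψ : ℕ → (Subset n → Bool) → Subset n → Bool
  ψ i W τ = isFaceOfDim (suc i) τ
          ∧ any (λ σ  → W σ ∧ does (σ ⊆? τ)) (faces i)
          ∧ any (λ σ′ → not (W σ′) ∧ does (σ′ ⊆? τ)) (faces i)

  SubsetOfFaces : ℕ → (Subset n → Bool) → Set
  SubsetOfFaces i W = ∀ σ → T (W σ) → T (isFaceOfDim i σ)

  ColorfulExpander : ℕ → ℚ → Set
  ColorfulExpander d ε =
    0ℚ ℚ.< ε ×
    (∀ i → i ℕ.< d → (W : Subset n → Bool) → SubsetOfFaces i W →
       (pos : 0ℚ ℚ.< norm d i W) → norm d i W ℚ.≤ ½ →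
       ε ℚ.≤ _÷_ (norm d (suc i) (ψ i W)) (norm d i W) {{>-nonZero pos}})

record Multigraph (A : Set) : Set where
  field
    vertices : List A
    mult     : A → A → ℕ

module _ {A : Set} (G : Multigraph A) where
  open Multigraph G

  degG : A → ℕ
  degG v = sumOver vertices (mult v)

  vol : (A → Bool) → ℕ
  vol S = sumOver (filterᵇ S vertices) degG

  cut : (A → Bool) → ℕ
  cut S = sumOver (filterᵇ S vertices)
            (λ v → sumOver (filterᵇ (not ∘ S) vertices) (mult v))

  Φ : (A → Bool) → ℚ
  Φ S = frac (cut S) (vol S)

  ConductanceAtLeast : ℚ → Set
  ConductanceAtLeast c =
    (S : A → Bool) → (∃ λ v → v ∈ vertices × T (S v)) →
    2 * vol S ℕ.≤ vol (λ _ → true) → c ℚ.≤ Φ S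

iGraph : {n : ℕ} → SimplicialComplex n → ℕ → ℕ → Multigraph (Subset n)
iGraph X d i = record
  { vertices = faces X i
  ; mult     = λ σ σ′ → if not (σ ≟S σ′) ∧ isFaceOfDim X (suc i) (σ ∪ σ′)
                        then deg X d (σ ∪ σ′) else 0
  }

-- Every i-face σ has degree (i+1)(d−i)·deg σ in G_i(X), because each d-face ρ ⊇ σ
-- contains exactly (i+1)(d−i) i-faces adjacent to σ; hence vol(S) = (i+1)(d−i)·Σ_{σ∈S} deg σ and
-- vol(S) ≤ vol/2 means ‖S‖ ≤ 1/2.  Counting pairs (i-face ⊆ d-face) gives
-- Σ_{X(i)} deg = |X(d)|·C(d+1,i+1), so (d−i)·Σ_{X(i)} deg = (i+2)·Σ_{X(i+1)} deg.
-- An edge σσ′ of the cut lies in the single (i+1)-face τ = σ ∪ σ′, so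
-- |E(S,S̄)| = Σ_τ deg τ·k_τ·l_τ, where k_τ + l_τ = i+2 count the facets of τ inside and outside S.
-- For τ ∈ ψ(S) both counts are positive, so k_τ·l_τ ≥ i+1, and therefore
-- Φ(S) ≥ Σ_{ψ(S)} deg / ((d−i)·Σ_S deg) = ‖ψ(S)‖/‖S‖ / (i+2) ≥ ε/(i+2).

module Submission where

open import Defs

-- A scope of its own keeps ℕ's _*_ apart from ℚ's _*_, which the statement of lemma3p4 uses unqualified.
module _ where

  open import Function using (_∘_; Equivalence)
  open import Data.Nat as ℕ using (ℕ; zero; suc; _+_; _*_; _∸_; _≤_; _<_; z≤n; s≤s; _≡ᵇ_)
  import Data.Nat.Properties as ℕₚ
  open import Data.Nat.Combinatorics using (_C_; nCk+nC[k+1]≡[n+1]C[k+1]; nCk≡nC[n∸k]; nCn≡1; nC1≡n; k>n⇒nCk≡0)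
  open import Data.Bool using (Bool; true; false; T; _∧_; not; if_then_else_)
  import Data.Bool.Properties as Boolₚ
  open import Data.Bool.ListAction using (any)
  open import Data.List using (List; []; _∷_; filterᵇ; map; length; _++_)
  open import Data.List.Membership.Propositional using (_∈_; find)
  open import Data.List.Membership.Propositional.Properties using (∈-++⁺ˡ; ∈-++⁺ʳ; ∈-map⁺; ∈-filter⁺; ∈-filter⁻)
  open import Data.List.Relation.Unary.Any using (here; there)
  open import Data.List.Relation.Unary.Any.Properties using (any⁻)
  import Data.List.Relation.Unary.All as All
  open import Data.List.Properties using (filter-all)
  open import Data.Vec using ([]; _∷_)
  import Data.Vec.Properties
  open import Data.Fin.Subset using (Subset; inside; outside; ⊥; _⊆_; _∪_; _∩_; _─_; ∣_∣)
  open import Data.Fin.Subset.Properties using (_⊆?_; p⊆q⇒∣p∣≤∣q∣; p⊆p∪q; q⊆p∪q; ∣p∣≤∣p∪q∣; x∈p∪q⁻; ∣p∩q∣≤∣p∣; ∣⊥∣≡0; ⊥⊆; p─⊥≡p)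
  import Data.Integer as ℤ
  import Data.Integer.Properties as ℤₚ
  open import Data.Rational as ℚ using (ℚ; 0ℚ; ½)
  import Data.Rational.Properties as ℚₚ
  import Data.Rational.Unnormalised as ℚᵘ
  import Data.Rational.Unnormalised.Properties as ℚᵘₚ
  open import Data.Product using (_×_; _,_; proj₁; proj₂)
  open import Data.Empty using (⊥-elim)
  open import Data.Sum using (inj₁; inj₂; [_,_]′)
  open import Data.Unit using (tt)
  open import Relation.Nullary using (yes; no; contradiction)
  open import Relation.Nullary.Decidable using (does; T?)
  open import Relation.Binary.PropositionalEquality
  open import Data.Nat.Solver using (module +-*-Solver)
  open +-*-Solver using (solve; _:+_; _:*_; _:=_; con)

  infixl 5 _when_

  _when_ : ℕ → Bool → ℕ
  x when b = if b then x else 0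

  0-when : ∀ b → 0 when b ≡ 0
  0-when true  = refl
  0-when false = refl

  0-when-when : ∀ b c → 0 when b when c ≡ 0
  0-when-when b true  = 0-when b
  0-when-when b false = refl

  when≡*1when : ∀ x b → x when b ≡ x * (1 when b)
  when≡*1when x true  = sym (ℕₚ.*-identityʳ x)
  when≡*1when x false = sym (ℕₚ.*-zeroʳ x)

  T⇒≡true : ∀ {b} → T b → b ≡ true
  T⇒≡true {true} _ = refl

  ∧≡true⇒× : ∀ {a b} → a ∧ b ≡ true → a ≡ true × b ≡ true
  ∧≡true⇒× {true} {true} refl = refl , refl

  when-when : (x : ℕ) (b c : Bool) → (x when b) when c ≡ x when (c ∧ b)
  when-when x b true  = refl
  when-when x b false = refl

  ≡ᵇ-refl : ∀ m → (m ≡ᵇ m) ≡ true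
  ≡ᵇ-refl zero    = refl
  ≡ᵇ-refl (suc m) = ≡ᵇ-refl m

  ≢⇒≡ᵇ-false : ∀ {m n} → m ≢ n → (m ≡ᵇ n) ≡ false
  ≢⇒≡ᵇ-false {m} {n} m≢n with m ≡ᵇ n in eq
  ... | true  = ⊥-elim (m≢n (ℕₚ.≡ᵇ⇒≡ m n (subst T (sym eq) tt)))
  ... | false = refl

  k+l≡2+j⇒1+j≤k*l : ∀ j k l → 1 ≤ k → 1 ≤ l → k + l ≡ suc (suc j) → suc j ≤ k * l
  k+l≡2+j⇒1+j≤k*l j (suc k) (suc l) _ _ k+l≡2+j = begin
    suc j              ≡⟨ cong suc (ℕₚ.suc-injective (trans (sym (ℕₚ.+-suc k l)) (ℕₚ.suc-injective k+l≡2+j))) ⟨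
    suc (k + l)        ≡⟨ cong suc (ℕₚ.+-comm k l) ⟩
    suc l + k          ≤⟨ ℕₚ.+-monoʳ-≤ (suc l) (ℕₚ.m≤m*n k (suc l)) ⟩
    suc l + k * suc l  ∎
    where open ℕₚ.≤-Reasoning

  -- Read with ∣ σ ∣ = j + 1, a = ∣ σ ∩ σ′ ∣, b = ∣ σ′ ─ σ ∣ and e = σ ≟S σ′: a (j+1)-set σ′ ≠ σ with
  -- ∣ σ ∪ σ′ ∣ = j + 2 is exactly one sharing j elements with σ and having one element outside σ.
  neighbour-sizes : ∀ j a b (e : Bool) → (e ≡ true → b ≡ 0) →
    (a + b ≡ᵇ suc j) ∧ not e ∧ (suc j + b ≡ᵇ suc (suc j)) ≡ (a ≡ᵇ j) ∧ (b ≡ᵇ 1)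
  neighbour-sizes j a zero e _
    rewrite ℕₚ.+-identityʳ j | ≢⇒≡ᵇ-false {j} {suc j} (ℕₚ.1+n≢n ∘ sym)
          | Boolₚ.∧-zeroʳ (not e) | Boolₚ.∧-zeroʳ (a + 0 ≡ᵇ suc j) | Boolₚ.∧-zeroʳ (a ≡ᵇ j) = refl
  neighbour-sizes j a 1 true e≡true⇒1≡0 with () ← e≡true⇒1≡0 refl
  neighbour-sizes j a 1 false _ rewrite ℕₚ.+-comm a 1 | ℕₚ.+-comm j 1 | ≡ᵇ-refl j = refl
  neighbour-sizes j a (suc (suc b)) e _
    rewrite ≢⇒≡ᵇ-false {j + suc (suc b)} {suc j}
              (λ eq → ℕₚ.m+1+n≢m j (ℕₚ.suc-injective (trans (sym (ℕₚ.+-suc j (suc b))) eq)))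
          | Boolₚ.∧-zeroʳ (not e) | Boolₚ.∧-zeroʳ (a + suc (suc b) ≡ᵇ suc j) | Boolₚ.∧-zeroʳ (a ≡ᵇ j) = refl

  module _ {A : Set} where

    sumOver-++ : (xs ys : List A) (f : A → ℕ) → sumOver (xs ++ ys) f ≡ sumOver xs f + sumOver ys f
    sumOver-++ []       ys f = refl
    sumOver-++ (x ∷ xs) ys f = trans (cong (f x +_) (sumOver-++ xs ys f)) (sym (ℕₚ.+-assoc (f x) _ _))

    sumOver-cong : (xs : List A) {f g : A → ℕ} → (∀ x → f x ≡ g x) → sumOver xs f ≡ sumOver xs g
    sumOver-cong []       f≡g = refl
    sumOver-cong (x ∷ xs) f≡g = cong₂ _+_ (f≡g x) (sumOver-cong xs f≡g)

    sumOver-cong-∈ : (xs : List A) {f g : A → ℕ} → (∀ {x} → x ∈ xs → f x ≡ g x) → sumOver xs f ≡ sumOver xs g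
    sumOver-cong-∈ []       f≡g = refl
    sumOver-cong-∈ (x ∷ xs) f≡g = cong₂ _+_ (f≡g (here refl)) (sumOver-cong-∈ xs (f≡g ∘ there))

    sumOver-mono : (xs : List A) {f g : A → ℕ} → (∀ x → f x ≤ g x) → sumOver xs f ≤ sumOver xs g
    sumOver-mono []       f≤g = z≤n
    sumOver-mono (x ∷ xs) f≤g = ℕₚ.+-mono-≤ (f≤g x) (sumOver-mono xs f≤g)

    sumOver-≡0 : (xs : List A) {f : A → ℕ} → (∀ x → f x ≡ 0) → sumOver xs f ≡ 0
    sumOver-≡0 []       f≡0 = refl
    sumOver-≡0 (x ∷ xs) f≡0 = cong₂ _+_ (f≡0 x) (sumOver-≡0 xs f≡0)

    sumOver-+ : (xs : List A) (f g : A → ℕ) → sumOver xs (λ x → f x + g x) ≡ sumOver xs f + sumOver xs g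
    sumOver-+ []       f g = refl
    sumOver-+ (x ∷ xs) f g = trans (cong (f x + g x +_) (sumOver-+ xs f g))
      (solve 4 (λ a b c d → (a :+ b) :+ (c :+ d) := (a :+ c) :+ (b :+ d)) refl (f x) (g x) (sumOver xs f) (sumOver xs g))

    *-distribˡ-sumOver : (c : ℕ) (xs : List A) (f : A → ℕ) → c * sumOver xs f ≡ sumOver xs (λ x → c * f x)
    *-distribˡ-sumOver c []       f = ℕₚ.*-zeroʳ c
    *-distribˡ-sumOver c (x ∷ xs) f = trans (ℕₚ.*-distribˡ-+ c (f x) _) (cong (c * f x +_) (*-distribˡ-sumOver c xs f))

    when-sumOver : (b : Bool) (xs : List A) (f : A → ℕ) → sumOver xs f when b ≡ sumOver xs (λ x → f x when b)
    when-sumOver true  xs f = refl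
    when-sumOver false xs f = sym (sumOver-≡0 xs (λ _ → refl))

    sumOver-filterᵇ : (p : A → Bool) (xs : List A) (f : A → ℕ) →
      sumOver (filterᵇ p xs) f ≡ sumOver xs (λ x → f x when p x)
    sumOver-filterᵇ p []       f = refl
    sumOver-filterᵇ p (x ∷ xs) f with p x
    ... | true  = cong (f x +_) (sumOver-filterᵇ p xs f)
    ... | false = sumOver-filterᵇ p xs f

    length-filterᵇ : (p : A → Bool) (xs : List A) → length (filterᵇ p xs) ≡ sumOver xs (λ x → 1 when p x)
    length-filterᵇ p []       = refl
    length-filterᵇ p (x ∷ xs) with p x
    ... | true  = cong suc (length-filterᵇ p xs)
    ... | false = length-filterᵇ p xs

    filterᵇ-∧-filterᵇ : (q p : A → Bool) (xs : List A) →
      filterᵇ (λ x → q x ∧ p x) (filterᵇ q xs) ≡ filterᵇ p (filterᵇ q xs)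
    filterᵇ-∧-filterᵇ q p []       = refl
    filterᵇ-∧-filterᵇ q p (x ∷ xs) with q x in qx
    ... | false = filterᵇ-∧-filterᵇ q p xs
    ... | true rewrite qx with p x
    ...   | true  = cong (x ∷_) (filterᵇ-∧-filterᵇ q p xs)
    ...   | false = filterᵇ-∧-filterᵇ q p xs

    ≤-sumOver : (xs : List A) (f : A → ℕ) {x : A} → x ∈ xs → f x ≤ sumOver xs f
    ≤-sumOver (y ∷ xs) f (here refl) = ℕₚ.m≤m+n (f y) _
    ≤-sumOver (y ∷ xs) f (there x∈) = ℕₚ.≤-trans (≤-sumOver xs f x∈) (ℕₚ.m≤n+m _ (f y))

    any-filterᵇ⇒1≤sumOver : (q p : A → Bool) (xs : List A) → any p (filterᵇ q xs) ≡ true →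
      1 ≤ sumOver xs (λ x → 1 when (q x ∧ p x))
    any-filterᵇ⇒1≤sumOver q p xs some with find (any⁻ p _ (subst T (sym some) tt))
    ... | x , x∈ , px with ∈-filter⁻ (T? ∘ q) x∈
    ...   | x∈xs , qx = subst (λ b → 1 when b ≤ sumOver xs (λ x → 1 when (q x ∧ p x)))
                              (cong₂ _∧_ (T⇒≡true qx) (T⇒≡true px))
                              (≤-sumOver xs (λ x → 1 when (q x ∧ p x)) x∈xs)

  module _ {A B : Set} where

    sumOver-comm : (xs : List A) (ys : List B) (f : A → B → ℕ) →
      sumOver xs (λ x → sumOver ys (f x)) ≡ sumOver ys (λ y → sumOver xs (λ x → f x y))
    sumOver-comm []       ys f = sym (sumOver-≡0 ys (λ _ → refl))
    sumOver-comm (x ∷ xs) ys f = trans (cong (sumOver ys (f x) +_) (sumOver-comm xs ys f))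
      (sym (sumOver-+ ys (f x) (λ y → sumOver xs (λ x → f x y))))

    sumOver-map : (g : B → A) (ys : List B) (f : A → ℕ) → sumOver (map g ys) f ≡ sumOver ys (f ∘ g)
    sumOver-map g []       f = refl
    sumOver-map g (y ∷ ys) f = cong (f (g y) +_) (sumOver-map g ys f)

    sumOver-when-sumOver : (xs : List A) (ys : List B) (p : A → Bool) (h : B → ℕ) →
      sumOver xs (λ x → sumOver ys (λ y → h y when p x)) ≡ sumOver xs (λ x → 1 when p x) * sumOver ys h
    sumOver-when-sumOver []       ys p h = refl
    sumOver-when-sumOver (x ∷ xs) ys p h with p x
    ... | true  = cong (sumOver ys h +_) (sumOver-when-sumOver xs ys p h)
    ... | false = cong₂ _+_ (sumOver-≡0 ys (λ _ → refl)) (sumOver-when-sumOver xs ys p h)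

  module _ {n : ℕ} where

    _⊆ᵇ_ : Subset n → Subset n → Bool
    σ ⊆ᵇ τ = does (σ ⊆? τ)

    ⊆ᵇ⇒⊆ : {σ τ : Subset n} → σ ⊆ᵇ τ ≡ true → σ ⊆ τ
    ⊆ᵇ⇒⊆ {σ} {τ} _ with σ ⊆? τ
    ... | yes σ⊆τ = σ⊆τ

    ⊆⇒⊆ᵇ : {σ τ : Subset n} → σ ⊆ τ → σ ⊆ᵇ τ ≡ true
    ⊆⇒⊆ᵇ {σ} {τ} σ⊆τ with σ ⊆? τ
    ... | yes _  = refl
    ... | no σ⊈τ = ⊥-elim (σ⊈τ σ⊆τ)

    ≟S⇒≡ : (σ τ : Subset n) → σ ≟S τ ≡ true → σ ≡ τ
    ≟S⇒≡ σ τ _ with Data.Vec.Properties.≡-dec Boolₚ._≟_ σ τ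
    ... | yes σ≡τ = σ≡τ

    ≡⇒≟S-true : (σ τ : Subset n) → σ ≡ τ → σ ≟S τ ≡ true
    ≡⇒≟S-true σ τ σ≡τ with Data.Vec.Properties.≡-dec Boolₚ._≟_ σ τ
    ... | yes _  = refl
    ... | no σ≢τ = ⊥-elim (σ≢τ σ≡τ)

    ≢⇒≟S-false : (σ τ : Subset n) → σ ≢ τ → σ ≟S τ ≡ false
    ≢⇒≟S-false σ τ σ≢τ with σ ≟S τ in eq
    ... | true  = ⊥-elim (σ≢τ (≟S⇒≡ σ τ eq))
    ... | false = refl

    ∪-⊆ᵇ : (σ σ′ ρ : Subset n) → (σ ∪ σ′) ⊆ᵇ ρ ≡ σ ⊆ᵇ ρ ∧ σ′ ⊆ᵇ ρ
    ∪-⊆ᵇ σ σ′ ρ with σ ⊆? ρ | σ′ ⊆? ρ | (σ ∪ σ′) ⊆? ρ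
    ... | yes σ⊆ρ | yes σ′⊆ρ | no σ∪σ′⊈ρ = ⊥-elim (σ∪σ′⊈ρ ([ σ⊆ρ , σ′⊆ρ ]′ ∘ x∈p∪q⁻ σ σ′))
    ... | yes _   | yes _    | yes _     = refl
    ... | no σ⊈ρ  | _        | yes σ∪σ′⊆ρ = ⊥-elim (σ⊈ρ (σ∪σ′⊆ρ ∘ p⊆p∪q σ′))
    ... | no _    | _        | no _      = refl
    ... | yes _   | no σ′⊈ρ  | yes σ∪σ′⊆ρ = ⊥-elim (σ′⊈ρ (σ∪σ′⊆ρ ∘ q⊆p∪q σ σ′))
    ... | yes _   | no _     | no _      = refl

    ⊆ᵇ-∪ˡ : (σ σ′ : Subset n) → σ ⊆ᵇ (σ ∪ σ′) ≡ true
    ⊆ᵇ-∪ˡ σ σ′ = ⊆⇒⊆ᵇ (p⊆p∪q {p = σ} σ′)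

    ⊆ᵇ-∪ʳ : (σ σ′ : Subset n) → σ′ ⊆ᵇ (σ ∪ σ′) ≡ true
    ⊆ᵇ-∪ʳ σ σ′ = ⊆⇒⊆ᵇ (q⊆p∪q σ σ′)

    ∪-⊆ᵇ-≡ : ∀ {b} (σ σ′ ρ : Subset n) → σ ⊆ᵇ ρ ≡ b → (σ ∪ σ′) ⊆ᵇ ρ ≡ b ∧ σ′ ⊆ᵇ ρ
    ∪-⊆ᵇ-≡ σ σ′ ρ σ⊆ρ = trans (∪-⊆ᵇ σ σ′ ρ) (cong (_∧ σ′ ⊆ᵇ ρ) σ⊆ρ)

  ∣q∣≡∣p∩q∣+∣q─p∣ : ∀ {n} (p q : Subset n) → ∣ q ∣ ≡ ∣ p ∩ q ∣ + ∣ q ─ p ∣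
  ∣q∣≡∣p∩q∣+∣q─p∣ []            []            = refl
  ∣q∣≡∣p∩q∣+∣q─p∣ (inside  ∷ p) (inside  ∷ q) = cong suc (∣q∣≡∣p∩q∣+∣q─p∣ p q)
  ∣q∣≡∣p∩q∣+∣q─p∣ (inside  ∷ p) (outside ∷ q) = ∣q∣≡∣p∩q∣+∣q─p∣ p q
  ∣q∣≡∣p∩q∣+∣q─p∣ (outside ∷ p) (inside  ∷ q) = trans (cong suc (∣q∣≡∣p∩q∣+∣q─p∣ p q)) (sym (ℕₚ.+-suc _ _))
  ∣q∣≡∣p∩q∣+∣q─p∣ (outside ∷ p) (outside ∷ q) = ∣q∣≡∣p∩q∣+∣q─p∣ p q

  ∣p∪q∣≡∣p∣+∣q─p∣ : ∀ {n} (p q : Subset n) → ∣ p ∪ q ∣ ≡ ∣ p ∣ + ∣ q ─ p ∣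
  ∣p∪q∣≡∣p∣+∣q─p∣ []            []            = refl
  ∣p∪q∣≡∣p∣+∣q─p∣ (inside  ∷ p) (inside  ∷ q) = cong suc (∣p∪q∣≡∣p∣+∣q─p∣ p q)
  ∣p∪q∣≡∣p∣+∣q─p∣ (inside  ∷ p) (outside ∷ q) = cong suc (∣p∪q∣≡∣p∣+∣q─p∣ p q)
  ∣p∪q∣≡∣p∣+∣q─p∣ (outside ∷ p) (inside  ∷ q) = trans (cong suc (∣p∪q∣≡∣p∣+∣q─p∣ p q)) (sym (ℕₚ.+-suc _ _))
  ∣p∪q∣≡∣p∣+∣q─p∣ (outside ∷ p) (outside ∷ q) = ∣p∪q∣≡∣p∣+∣q─p∣ p q

  ∣p─p∣≡0 : ∀ {n} (p : Subset n) → ∣ p ─ p ∣ ≡ 0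
  ∣p─p∣≡0 []            = refl
  ∣p─p∣≡0 (inside  ∷ p) = ∣p─p∣≡0 p
  ∣p─p∣≡0 (outside ∷ p) = ∣p─p∣≡0 p

  p⊆ᵇq⇒∣q∣≡∣p∣+∣q─p∣ : ∀ {n} (p q : Subset n) → p ⊆ᵇ q ≡ true → ∣ q ∣ ≡ ∣ p ∣ + ∣ q ─ p ∣
  p⊆ᵇq⇒∣q∣≡∣p∣+∣q─p∣ []            []            _   = refl
  p⊆ᵇq⇒∣q∣≡∣p∣+∣q─p∣ (inside  ∷ p) (inside  ∷ q) p⊆q = cong suc (p⊆ᵇq⇒∣q∣≡∣p∣+∣q─p∣ p q p⊆q)
  p⊆ᵇq⇒∣q∣≡∣p∣+∣q─p∣ (outside ∷ p) (inside  ∷ q) p⊆q =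
    trans (cong suc (p⊆ᵇq⇒∣q∣≡∣p∣+∣q─p∣ p q p⊆q)) (sym (ℕₚ.+-suc _ _))
  p⊆ᵇq⇒∣q∣≡∣p∣+∣q─p∣ (outside ∷ p) (outside ∷ q) p⊆q = p⊆ᵇq⇒∣q∣≡∣p∣+∣q─p∣ p q p⊆q

  p⊆ᵇq⇒∣q─p∣≡∣q∣∸∣p∣ : ∀ {n} (p q : Subset n) → p ⊆ᵇ q ≡ true → ∣ q ─ p ∣ ≡ ∣ q ∣ ∸ ∣ p ∣
  p⊆ᵇq⇒∣q─p∣≡∣q∣∸∣p∣ p q p⊆q =
    trans (sym (ℕₚ.m+n∸m≡n ∣ p ∣ ∣ q ─ p ∣)) (cong (_∸ ∣ p ∣) (sym (p⊆ᵇq⇒∣q∣≡∣p∣+∣q─p∣ p q p⊆q)))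

  p⊆ᵇq∧∣p∣≡∣q∣⇒p≡q : ∀ {n} (p q : Subset n) → p ⊆ᵇ q ≡ true → ∣ p ∣ ≡ ∣ q ∣ → p ≡ q
  p⊆ᵇq∧∣p∣≡∣q∣⇒p≡q []            []            _   _ = refl
  p⊆ᵇq∧∣p∣≡∣q∣⇒p≡q (inside  ∷ p) (inside  ∷ q) p⊆q e = cong (inside ∷_) (p⊆ᵇq∧∣p∣≡∣q∣⇒p≡q p q p⊆q (ℕₚ.suc-injective e))
  p⊆ᵇq∧∣p∣≡∣q∣⇒p≡q (outside ∷ p) (outside ∷ q) p⊆q e = cong (outside ∷_) (p⊆ᵇq∧∣p∣≡∣q∣⇒p≡q p q p⊆q e)
  p⊆ᵇq∧∣p∣≡∣q∣⇒p≡q (outside ∷ p) (inside  ∷ q) p⊆q e =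
    ⊥-elim (ℕₚ.<-irrefl refl (subst (_≤ ∣ q ∣) e (p⊆q⇒∣p∣≤∣q∣ (⊆ᵇ⇒⊆ {σ = p} p⊆q))))

  distinct-⊆ᵇ⇒∪≡ : ∀ {n} (j : ℕ) (σ σ′ τ : Subset n) → ∣ σ ∣ ≡ suc j → ∣ σ′ ∣ ≡ suc j → ∣ τ ∣ ≡ suc (suc j) →
    σ ≢ σ′ → σ ⊆ᵇ τ ≡ true → σ′ ⊆ᵇ τ ≡ true → σ ∪ σ′ ≡ τ
  distinct-⊆ᵇ⇒∪≡ j σ σ′ τ ∣σ∣ ∣σ′∣ ∣τ∣ σ≢σ′ σ⊆τ σ′⊆τ = p⊆ᵇq∧∣p∣≡∣q∣⇒p≡q (σ ∪ σ′) τ ∪⊆τ ∣∪∣≡∣τ∣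
    where
    ∪⊆τ : (σ ∪ σ′) ⊆ᵇ τ ≡ true
    ∪⊆τ = trans (∪-⊆ᵇ σ σ′ τ) (cong₂ _∧_ σ⊆τ σ′⊆τ)
    ∣∪∣≤ : ∣ σ ∪ σ′ ∣ ≤ suc (suc j)
    ∣∪∣≤ = subst (∣ σ ∪ σ′ ∣ ≤_) ∣τ∣ (p⊆q⇒∣p∣≤∣q∣ (⊆ᵇ⇒⊆ {σ = σ ∪ σ′} ∪⊆τ))
    ∣∪∣≥ : suc j ≤ ∣ σ ∪ σ′ ∣
    ∣∪∣≥ = subst (_≤ ∣ σ ∪ σ′ ∣) ∣σ∣ (∣p∣≤∣p∪q∣ σ σ′)
    ∣∪∣≢ : ∣ σ ∪ σ′ ∣ ≢ suc j
    ∣∪∣≢ e = σ≢σ′ (trans (p⊆ᵇq∧∣p∣≡∣q∣⇒p≡q σ (σ ∪ σ′) (⊆ᵇ-∪ˡ σ σ′) (trans ∣σ∣ (sym e)))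
                         (sym (p⊆ᵇq∧∣p∣≡∣q∣⇒p≡q σ′ (σ ∪ σ′) (⊆ᵇ-∪ʳ σ σ′) (trans ∣σ′∣ (sym e)))))
    ∣∪∣≡∣τ∣ : ∣ σ ∪ σ′ ∣ ≡ ∣ τ ∣
    ∣∪∣≡∣τ∣ with ℕₚ.m≤n⇒m<n∨m≡n ∣∪∣≤
    ... | inj₂ e         = trans e (sym ∣τ∣)
    ... | inj₁ (s≤s ∣∪∣≤j+1) = ⊥-elim (∣∪∣≢ (ℕₚ.≤-antisym ∣∪∣≤j+1 ∣∪∣≥))

  ∑ : ∀ {n} → (Subset n → ℕ) → ℕ
  ∑ f = sumOver (allSubsets _) f

  syntax ∑ (λ σ → e) = ∑[ σ ] e

  ∑-suc : ∀ {n} (f : Subset (suc n) → ℕ) → ∑ f ≡ ∑[ σ ] f (outside ∷ σ) + ∑[ σ ] f (inside ∷ σ)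
  ∑-suc {n} f = trans (sumOver-++ (map (outside ∷_) (allSubsets n)) _ f)
    (cong₂ _+_ (sumOver-map (outside ∷_) (allSubsets n) f) (sumOver-map (inside ∷_) (allSubsets n) f))

  ∈-allSubsets : ∀ {n} (σ : Subset n) → σ ∈ allSubsets n
  ∈-allSubsets []            = here refl
  ∈-allSubsets (outside ∷ σ) = ∈-++⁺ˡ (∈-map⁺ (outside ∷_) (∈-allSubsets σ))
  ∈-allSubsets (inside  ∷ σ) = ∈-++⁺ʳ (map (outside ∷_) (allSubsets _)) (∈-map⁺ (inside ∷_) (∈-allSubsets σ))

  ∑-0 : ∀ {n} → ∑ {n} (λ _ → 0) ≡ 0
  ∑-0 {n} = sumOver-≡0 (allSubsets n) (λ _ → refl)

  ∑-when-≟S : ∀ {n} (σ : Subset n) (f : Subset n → ℕ) → ∑[ τ ] (f τ when (τ ≟S σ)) ≡ f σ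
  ∑-when-≟S []            f = ℕₚ.+-identityʳ (f [])
  ∑-when-≟S {suc n} (outside ∷ σ) f = trans (∑-suc (λ τ → f τ when (τ ≟S (outside ∷ σ))))
    (trans (cong₂ _+_ (∑-when-≟S σ (f ∘ (outside ∷_))) (∑-0 {n})) (ℕₚ.+-identityʳ _))
  ∑-when-≟S {suc n} (inside  ∷ σ) f = trans (∑-suc (λ τ → f τ when (τ ≟S (inside ∷ σ))))
    (cong₂ _+_ (∑-0 {n}) (∑-when-≟S σ (f ∘ (inside ∷_))))

  nC0≡1 : ∀ n → n C 0 ≡ 1
  nC0≡1 n = trans (nCk≡nC[n∸k] (z≤n {n})) (nCn≡1 n)

  [1+n]Cn≡1+n : ∀ n → suc n C n ≡ suc n
  [1+n]Cn≡1+n n = trans (nCk≡nC[n∸k] (ℕₚ.n≤1+n n)) (trans (cong (suc n C_) (ℕₚ.m+n∸n≡m 1 n)) (nC1≡n (suc n)))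

  nCk*[n∸k]≡nC[1+k]*[1+k] : ∀ n k → (n C k) * (n ∸ k) ≡ (n C suc k) * suc k
  nCk*[n∸k]≡nC[1+k]*[1+k] zero k = begin
    (0 C k) * (0 ∸ k)    ≡⟨ cong ((0 C k) *_) (ℕₚ.0∸n≡0 k) ⟩
    (0 C k) * 0          ≡⟨ ℕₚ.*-zeroʳ (0 C k) ⟩
    0                    ≡⟨ cong (_* suc k) (k>n⇒nCk≡0 (s≤s (z≤n {k}))) ⟨
    (0 C suc k) * suc k  ∎
    where open ≡-Reasoning
  nCk*[n∸k]≡nC[1+k]*[1+k] (suc n) zero = begin
    (suc n C 0) * suc n  ≡⟨ cong (_* suc n) (nC0≡1 (suc n)) ⟩
    1 * suc n            ≡⟨ ℕₚ.*-comm 1 (suc n) ⟩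
    suc n * 1            ≡⟨ cong (_* 1) (nC1≡n (suc n)) ⟨
    (suc n C 1) * 1      ∎
    where open ≡-Reasoning
  nCk*[n∸k]≡nC[1+k]*[1+k] (suc n) (suc k) with k ℕ.<? n
  ... | yes k<n = begin
    (suc n C suc k) * (n ∸ k)           ≡⟨ cong₂ _*_ (sym (nCk+nC[k+1]≡[n+1]C[k+1] n k)) n∸k≡1+u ⟩
    (a + b) * suc u                     ≡⟨ solve 3 (λ a b u → (a :+ b) :* (con 1 :+ u) := a :* (con 1 :+ u) :+ (b :+ b :* u))
                                                   refl a b u ⟩
    a * suc u + (b + b * u)             ≡⟨ cong₂ (λ x y → x + (b + y)) step₁ (nCk*[n∸k]≡nC[1+k]*[1+k] n (suc k)) ⟩
    b * suc k + (b + c * suc (suc k))   ≡⟨ solve 3 (λ b c k → b :* (con 1 :+ k) :+ (b :+ c :* (con 2 :+ k)) := (b :+ c) :* (con 2 :+ k))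
                                                   refl b c k ⟩
    (b + c) * suc (suc k)               ≡⟨ cong (_* suc (suc k)) (nCk+nC[k+1]≡[n+1]C[k+1] n (suc k)) ⟩
    (suc n C suc (suc k)) * suc (suc k) ∎
    where
    open ≡-Reasoning
    a = n C k
    b = n C suc k
    c = n C suc (suc k)
    u = n ∸ suc k
    n∸k≡1+u : n ∸ k ≡ suc u
    n∸k≡1+u = ℕₚ.+-∸-assoc 1 k<n
    step₁ : a * suc u ≡ b * suc k
    step₁ = trans (cong (a *_) (sym n∸k≡1+u)) (nCk*[n∸k]≡nC[1+k]*[1+k] n k)
  ... | no k≮n = begin
    (suc n C suc k) * (n ∸ k)           ≡⟨ cong ((suc n C suc k) *_) (ℕₚ.m≤n⇒m∸n≡0 n≤k) ⟩
    (suc n C suc k) * 0                 ≡⟨ ℕₚ.*-zeroʳ (suc n C suc k) ⟩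
    0                                   ≡⟨ cong (_* suc (suc k)) (k>n⇒nCk≡0 (s≤s (s≤s n≤k))) ⟨
    (suc n C suc (suc k)) * suc (suc k) ∎
    where
    open ≡-Reasoning
    n≤k = ℕₚ.≮⇒≥ k≮n

  ∑-⊆-overlap : ∀ {n} (σ ρ : Subset n) → σ ⊆ᵇ ρ ≡ true → ∀ a b →
    ∑[ σ′ ] (1 when (σ′ ⊆ᵇ ρ ∧ (∣ σ ∩ σ′ ∣ ≡ᵇ a) ∧ (∣ σ′ ─ σ ∣ ≡ᵇ b))) ≡ (∣ σ ∣ C a) * (∣ ρ ─ σ ∣ C b)
  ∑-⊆-overlap [] [] _ zero    zero    = refl
  ∑-⊆-overlap [] [] _ zero    (suc b) = refl
  ∑-⊆-overlap [] [] _ (suc a) zero    = refl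
  ∑-⊆-overlap [] [] _ (suc a) (suc b) = refl
  ∑-⊆-overlap {suc n} (outside ∷ σ) (outside ∷ ρ) σ⊆ρ a b =
    trans (∑-suc {n} _) (trans (cong₂ _+_ (∑-⊆-overlap σ ρ σ⊆ρ a b) (∑-0 {n})) (ℕₚ.+-identityʳ _))
  ∑-⊆-overlap {suc n} (outside ∷ σ) (inside ∷ ρ) σ⊆ρ a zero = begin
    ∑ {suc n} _                                        ≡⟨ ∑-suc {n} _ ⟩
    ∑ {n} _ + ∑ {n} _                                  ≡⟨ cong₂ _+_ (∑-⊆-overlap σ ρ σ⊆ρ a 0) (sumOver-≡0 (allSubsets n) no-σ′) ⟩
    (∣ σ ∣ C a) * (∣ ρ ─ σ ∣ C 0) + 0                  ≡⟨ ℕₚ.+-identityʳ _ ⟩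
    (∣ σ ∣ C a) * (∣ ρ ─ σ ∣ C 0)                      ≡⟨ cong ((∣ σ ∣ C a) *_) (trans (nC0≡1 ∣ ρ ─ σ ∣) (sym (nC0≡1 (suc ∣ ρ ─ σ ∣)))) ⟩
    (∣ σ ∣ C a) * (suc ∣ ρ ─ σ ∣ C 0)                  ∎
    where
    open ≡-Reasoning
    no-σ′ : ∀ σ′ → 1 when (σ′ ⊆ᵇ ρ ∧ (∣ σ ∩ σ′ ∣ ≡ᵇ a) ∧ false) ≡ 0
    no-σ′ σ′ rewrite Boolₚ.∧-zeroʳ (∣ σ ∩ σ′ ∣ ≡ᵇ a) | Boolₚ.∧-zeroʳ (σ′ ⊆ᵇ ρ) = refl
  ∑-⊆-overlap {suc n} (outside ∷ σ) (inside ∷ ρ) σ⊆ρ a (suc b) = begin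
    ∑ {suc n} _                                        ≡⟨ ∑-suc {n} _ ⟩
    ∑ {n} _ + ∑ {n} _                                  ≡⟨ cong₂ _+_ (∑-⊆-overlap σ ρ σ⊆ρ a (suc b)) (∑-⊆-overlap σ ρ σ⊆ρ a b) ⟩
    (∣ σ ∣ C a) * (∣ ρ ─ σ ∣ C suc b) + (∣ σ ∣ C a) * (∣ ρ ─ σ ∣ C b)
                                                       ≡⟨ ℕₚ.*-distribˡ-+ (∣ σ ∣ C a) _ _ ⟨
    (∣ σ ∣ C a) * (∣ ρ ─ σ ∣ C suc b + ∣ ρ ─ σ ∣ C b)  ≡⟨ cong ((∣ σ ∣ C a) *_) (ℕₚ.+-comm (∣ ρ ─ σ ∣ C suc b) _) ⟩
    (∣ σ ∣ C a) * (∣ ρ ─ σ ∣ C b + ∣ ρ ─ σ ∣ C suc b)  ≡⟨ cong ((∣ σ ∣ C a) *_) (nCk+nC[k+1]≡[n+1]C[k+1] _ b) ⟩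
    (∣ σ ∣ C a) * (suc ∣ ρ ─ σ ∣ C suc b)              ∎
    where open ≡-Reasoning
  ∑-⊆-overlap {suc n} (inside ∷ σ) (inside ∷ ρ) σ⊆ρ zero b = begin
    ∑ {suc n} _                                        ≡⟨ ∑-suc {n} _ ⟩
    ∑ {n} _ + ∑ {n} _                                  ≡⟨ cong₂ _+_ (∑-⊆-overlap σ ρ σ⊆ρ 0 b) (sumOver-≡0 (allSubsets n) no-σ′) ⟩
    (∣ σ ∣ C 0) * (∣ ρ ─ σ ∣ C b) + 0                  ≡⟨ ℕₚ.+-identityʳ _ ⟩
    (∣ σ ∣ C 0) * (∣ ρ ─ σ ∣ C b)                      ≡⟨ cong (_* (∣ ρ ─ σ ∣ C b)) (trans (nC0≡1 ∣ σ ∣) (sym (nC0≡1 (suc ∣ σ ∣)))) ⟩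
    (suc ∣ σ ∣ C 0) * (∣ ρ ─ σ ∣ C b)                  ∎
    where
    open ≡-Reasoning
    no-σ′ : ∀ σ′ → 1 when (σ′ ⊆ᵇ ρ ∧ false ∧ (∣ σ′ ─ σ ∣ ≡ᵇ b)) ≡ 0
    no-σ′ σ′ rewrite Boolₚ.∧-zeroʳ (σ′ ⊆ᵇ ρ) = refl
  ∑-⊆-overlap {suc n} (inside ∷ σ) (inside ∷ ρ) σ⊆ρ (suc a) b = begin
    ∑ {suc n} _                                        ≡⟨ ∑-suc {n} _ ⟩
    ∑ {n} _ + ∑ {n} _                                  ≡⟨ cong₂ _+_ (∑-⊆-overlap σ ρ σ⊆ρ (suc a) b) (∑-⊆-overlap σ ρ σ⊆ρ a b) ⟩
    (∣ σ ∣ C suc a) * (∣ ρ ─ σ ∣ C b) + (∣ σ ∣ C a) * (∣ ρ ─ σ ∣ C b)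
                                                       ≡⟨ ℕₚ.*-distribʳ-+ (∣ ρ ─ σ ∣ C b) (∣ σ ∣ C suc a) _ ⟨
    (∣ σ ∣ C suc a + ∣ σ ∣ C a) * (∣ ρ ─ σ ∣ C b)      ≡⟨ cong (_* (∣ ρ ─ σ ∣ C b)) (ℕₚ.+-comm (∣ σ ∣ C suc a) _) ⟩
    (∣ σ ∣ C a + ∣ σ ∣ C suc a) * (∣ ρ ─ σ ∣ C b)      ≡⟨ cong (_* (∣ ρ ─ σ ∣ C b)) (nCk+nC[k+1]≡[n+1]C[k+1] _ a) ⟩
    (suc ∣ σ ∣ C suc a) * (∣ ρ ─ σ ∣ C b)              ∎
    where open ≡-Reasoning

  ∑-⊆-size : ∀ {n} (ρ : Subset n) (k : ℕ) → ∑[ σ ] (1 when (σ ⊆ᵇ ρ ∧ (∣ σ ∣ ≡ᵇ k))) ≡ ∣ ρ ∣ C k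
  ∑-⊆-size {n} ρ k = begin
    ∑[ σ ] (1 when (σ ⊆ᵇ ρ ∧ (∣ σ ∣ ≡ᵇ k)))                         ≡⟨ sumOver-cong (allSubsets n) via-⊥ ⟨
    ∑[ σ ] (1 when (σ ⊆ᵇ ρ ∧ (∣ ⊥ ∩ σ ∣ ≡ᵇ 0) ∧ (∣ σ ─ ⊥ ∣ ≡ᵇ k)))  ≡⟨ ∑-⊆-overlap ⊥ ρ (⊆⇒⊆ᵇ {σ = ⊥} {ρ} ⊥⊆) 0 k ⟩
    (∣ ⊥ {n} ∣ C 0) * (∣ ρ ─ ⊥ ∣ C k)                               ≡⟨ cong₂ _*_ (nC0≡1 ∣ ⊥ {n} ∣) (cong (λ τ → ∣ τ ∣ C k) (p─⊥≡p ρ)) ⟩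
    1 * (∣ ρ ∣ C k)                                                 ≡⟨ ℕₚ.*-identityˡ _ ⟩
    ∣ ρ ∣ C k                                                       ∎
    where
    open ≡-Reasoning
    ∣⊥∩σ∣≡0 : ∀ σ → ∣ ⊥ ∩ σ ∣ ≡ 0
    ∣⊥∩σ∣≡0 σ = ℕₚ.n≤0⇒n≡0 (subst (∣ ⊥ ∩ σ ∣ ≤_) (∣⊥∣≡0 n) (∣p∩q∣≤∣p∣ ⊥ σ))
    via-⊥ : ∀ σ → 1 when (σ ⊆ᵇ ρ ∧ (∣ ⊥ ∩ σ ∣ ≡ᵇ 0) ∧ (∣ σ ─ ⊥ ∣ ≡ᵇ k)) ≡ 1 when (σ ⊆ᵇ ρ ∧ (∣ σ ∣ ≡ᵇ k))
    via-⊥ σ rewrite ∣⊥∩σ∣≡0 σ | p─⊥≡p σ = refl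

  module _ {n : ℕ} (X : SimplicialComplex n) where
    open SimplicialComplex X

    isFace⇒face : ∀ k σ → isFaceOfDim X k σ ≡ true → face σ ≡ true
    isFace⇒face k σ isFace with face σ
    ... | true = refl

    isFace⇒size : ∀ k σ → isFaceOfDim X k σ ≡ true → ∣ σ ∣ ≡ suc k
    isFace⇒size k σ isFace with face σ
    ... | true = ℕₚ.≡ᵇ⇒≡ ∣ σ ∣ (suc k) (subst T (sym isFace) tt)

    ⊆ᵇ-face : ∀ {σ ρ} → face ρ ≡ true → σ ⊆ᵇ ρ ≡ true → face σ ≡ true
    ⊆ᵇ-face {σ} {ρ} faceρ σ⊆ρ with face σ in faceσ
    ... | true  = refl
    ... | false = ⊥-elim (subst T faceσ (down-closed (⊆ᵇ⇒⊆ {σ = σ} σ⊆ρ) (subst T (sym faceρ) tt)))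

    face⇒isFace≡ : ∀ k σ → face σ ≡ true → isFaceOfDim X k σ ≡ (∣ σ ∣ ≡ᵇ suc k)
    face⇒isFace≡ k σ faceσ = cong (_∧ (∣ σ ∣ ≡ᵇ suc k)) faceσ

    isFace∧⊆ᵇ : ∀ k σ ρ → face ρ ≡ true → isFaceOfDim X k σ ∧ σ ⊆ᵇ ρ ≡ σ ⊆ᵇ ρ ∧ (∣ σ ∣ ≡ᵇ suc k)
    isFace∧⊆ᵇ k σ ρ faceρ with σ ⊆ᵇ ρ in σ⊆ρ
    ... | false = Boolₚ.∧-zeroʳ _
    ... | true  = trans (Boolₚ.∧-identityʳ _) (face⇒isFace≡ k σ (⊆ᵇ-face faceρ σ⊆ρ))

    adjacent : ℕ → Subset n → Subset n → Bool
    adjacent i σ σ′ = not (σ ≟S σ′) ∧ isFaceOfDim X (suc i) (σ ∪ σ′)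

    neighbour⇔overlap : ∀ i σ σ′ ρ → isFaceOfDim X i σ ≡ true → face ρ ≡ true → σ ⊆ᵇ ρ ≡ true →
      isFaceOfDim X i σ′ ∧ adjacent i σ σ′ ∧ σ′ ⊆ᵇ ρ
        ≡ σ′ ⊆ᵇ ρ ∧ (∣ σ ∩ σ′ ∣ ≡ᵇ i) ∧ (∣ σ′ ─ σ ∣ ≡ᵇ 1)
    neighbour⇔overlap i σ σ′ ρ σ∈X[i] faceρ σ⊆ρ with σ′ ⊆ᵇ ρ in σ′⊆ρ
    ... | false rewrite Boolₚ.∧-zeroʳ (not (σ ≟S σ′) ∧ isFaceOfDim X (suc i) (σ ∪ σ′))
                      | Boolₚ.∧-zeroʳ (isFaceOfDim X i σ′) = refl
    ... | true
      rewrite face⇒isFace≡ i σ′ (⊆ᵇ-face faceρ σ′⊆ρ)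
            | face⇒isFace≡ (suc i) (σ ∪ σ′) (⊆ᵇ-face faceρ (trans (∪-⊆ᵇ σ σ′ ρ) (cong₂ _∧_ σ⊆ρ σ′⊆ρ)))
            | Boolₚ.∧-identityʳ (not (σ ≟S σ′) ∧ (∣ σ ∪ σ′ ∣ ≡ᵇ suc (suc i)))
            | ∣q∣≡∣p∩q∣+∣q─p∣ σ σ′ | ∣p∪q∣≡∣p∣+∣q─p∣ σ σ′ | isFace⇒size i σ σ∈X[i]
      = neighbour-sizes i ∣ σ ∩ σ′ ∣ ∣ σ′ ─ σ ∣ (σ ≟S σ′)
          (λ σ≟σ′ → subst (λ τ → ∣ τ ─ σ ∣ ≡ 0) (≟S⇒≡ σ σ′ σ≟σ′) (∣p─p∣≡0 σ))

    module _ (d : ℕ) where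

      deg≡∑ : ∀ τ → deg X d τ ≡ ∑[ ρ ] (1 when (isFaceOfDim X d ρ ∧ τ ⊆ᵇ ρ))
      deg≡∑ τ = length-filterᵇ _ (allSubsets n)

      pure⇒1≤deg : IsPure X d → ∀ σ → face σ ≡ true → 1 ≤ deg X d σ
      pure⇒1≤deg pure σ faceσ with pure σ (subst T (sym faceσ) tt)
      ... | τ , τ∈X[d] , σ⊆τ = begin
        1                                                ≡⟨ cong (1 when_) (cong₂ _∧_ (T⇒≡true τ∈X[d]) (⊆⇒⊆ᵇ σ⊆τ)) ⟨
        1 when isFaceOfDim X d τ ∧ σ ⊆ᵇ τ                ≤⟨ ≤-sumOver (allSubsets n) _ (∈-allSubsets τ) ⟩
        ∑[ ρ ] (1 when isFaceOfDim X d ρ ∧ σ ⊆ᵇ ρ)       ≡⟨ deg≡∑ σ ⟨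
        deg X d σ                                        ∎
        where open ℕₚ.≤-Reasoning

      deg-X : ℕ → ℕ
      deg-X k = sumOver (faces X k) (deg X d)

      deg-X-count : ∀ k → deg-X k ≡ length (faces X d) * (suc d C suc k)
      deg-X-count k = begin
        sumOver (faces X k) (deg X d)
          ≡⟨ sumOver-filterᵇ (isFaceOfDim X k) (allSubsets n) (deg X d) ⟩
        ∑[ σ ] (deg X d σ when isFaceOfDim X k σ)
          ≡⟨ sumOver-cong (allSubsets n) (λ σ → trans (cong (_when isFaceOfDim X k σ) (deg≡∑ σ))
                                                      (when-sumOver (isFaceOfDim X k σ) (allSubsets n) _)) ⟩
        ∑[ σ ] ∑[ ρ ] ((1 when (isFaceOfDim X d ρ ∧ σ ⊆ᵇ ρ)) when isFaceOfDim X k σ)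
          ≡⟨ sumOver-comm (allSubsets n) (allSubsets n) _ ⟩
        ∑[ ρ ] ∑[ σ ] ((1 when (isFaceOfDim X d ρ ∧ σ ⊆ᵇ ρ)) when isFaceOfDim X k σ)
          ≡⟨ sumOver-cong (allSubsets n) k-faces-of ⟩
        ∑[ ρ ] ((suc d C suc k) when isFaceOfDim X d ρ)
          ≡⟨ sumOver-cong (allSubsets n) (λ ρ → when≡*1when _ (isFaceOfDim X d ρ)) ⟩
        ∑[ ρ ] ((suc d C suc k) * (1 when isFaceOfDim X d ρ))
          ≡⟨ *-distribˡ-sumOver (suc d C suc k) (allSubsets n) _ ⟨
        (suc d C suc k) * ∑[ ρ ] (1 when isFaceOfDim X d ρ)
          ≡⟨ cong ((suc d C suc k) *_) (length-filterᵇ (isFaceOfDim X d) (allSubsets n)) ⟨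
        (suc d C suc k) * length (faces X d)
          ≡⟨ ℕₚ.*-comm (suc d C suc k) _ ⟩
        length (faces X d) * (suc d C suc k) ∎
        where
        open ≡-Reasoning
        k-faces-of : ∀ ρ → ∑[ σ ] ((1 when (isFaceOfDim X d ρ ∧ σ ⊆ᵇ ρ)) when isFaceOfDim X k σ)
                         ≡ (suc d C suc k) when isFaceOfDim X d ρ
        k-faces-of ρ with isFaceOfDim X d ρ in ρ∈X[d]
        ... | false = sumOver-≡0 (allSubsets n) (λ σ → 0-when (isFaceOfDim X k σ))
        ... | true  = begin
          ∑[ σ ] ((1 when σ ⊆ᵇ ρ) when isFaceOfDim X k σ)
            ≡⟨ sumOver-cong (allSubsets n) (λ σ → trans (when-when 1 (σ ⊆ᵇ ρ) (isFaceOfDim X k σ))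
                                                        (cong (1 when_) (isFace∧⊆ᵇ k σ ρ faceρ))) ⟩
          ∑[ σ ] (1 when (σ ⊆ᵇ ρ ∧ (∣ σ ∣ ≡ᵇ suc k)))
            ≡⟨ ∑-⊆-size ρ (suc k) ⟩
          ∣ ρ ∣ C suc k
            ≡⟨ cong (_C suc k) (isFace⇒size d ρ ρ∈X[d]) ⟩
          suc d C suc k ∎
          where faceρ = isFace⇒face d ρ ρ∈X[d]

      deg-X-ratio : ∀ i → deg-X i * (d ∸ i) ≡ deg-X (suc i) * suc (suc i)
      deg-X-ratio i = begin
        deg-X i * (d ∸ i)                                     ≡⟨ cong (_* (d ∸ i)) (deg-X-count i) ⟩
        length (faces X d) * (suc d C suc i) * (d ∸ i)              ≡⟨ ℕₚ.*-assoc (length (faces X d)) _ _ ⟩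
        length (faces X d) * ((suc d C suc i) * (d ∸ i))            ≡⟨ cong (length (faces X d) *_) (nCk*[n∸k]≡nC[1+k]*[1+k] (suc d) (suc i)) ⟩
        length (faces X d) * ((suc d C suc (suc i)) * suc (suc i))  ≡⟨ ℕₚ.*-assoc (length (faces X d)) _ _ ⟨
        length (faces X d) * (suc d C suc (suc i)) * suc (suc i)    ≡⟨ cong (_* suc (suc i)) (deg-X-count (suc i)) ⟨
        deg-X (suc i) * suc (suc i)                           ∎
        where open ≡-Reasoning

      adjacent-within : ∀ i σ ρ → isFaceOfDim X i σ ≡ true →
        ∑[ σ′ ] (1 when isFaceOfDim X d ρ ∧ (σ ∪ σ′) ⊆ᵇ ρ when adjacent i σ σ′ when isFaceOfDim X i σ′)
          ≡ suc i * (d ∸ i) when isFaceOfDim X d ρ ∧ σ ⊆ᵇ ρ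
      adjacent-within i σ ρ σ∈X[i] with isFaceOfDim X d ρ in ρ∈X[d] | σ ⊆ᵇ ρ in σ⊆ρ
      ... | false | _     = sumOver-≡0 (allSubsets n) (λ σ′ → 0-when-when (adjacent i σ σ′) (isFaceOfDim X i σ′))
      ... | true  | false = sumOver-≡0 (allSubsets n) (λ σ′ →
        trans (cong (λ b → 1 when b when adjacent i σ σ′ when isFaceOfDim X i σ′) (∪-⊆ᵇ-≡ σ σ′ ρ σ⊆ρ))
              (0-when-when (adjacent i σ σ′) (isFaceOfDim X i σ′)))
      ... | true  | true  = begin
        ∑[ σ′ ] (1 when (σ ∪ σ′) ⊆ᵇ ρ when adjacent i σ σ′ when isFaceOfDim X i σ′)
          ≡⟨ sumOver-cong (allSubsets n) (λ σ′ → begin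
               1 when (σ ∪ σ′) ⊆ᵇ ρ when adjacent i σ σ′ when isFaceOfDim X i σ′
                 ≡⟨ cong (λ b → 1 when b when adjacent i σ σ′ when isFaceOfDim X i σ′) (∪-⊆ᵇ-≡ σ σ′ ρ σ⊆ρ) ⟩
               1 when σ′ ⊆ᵇ ρ when adjacent i σ σ′ when isFaceOfDim X i σ′
                 ≡⟨ cong (_when isFaceOfDim X i σ′) (when-when 1 (σ′ ⊆ᵇ ρ) (adjacent i σ σ′)) ⟩
               1 when adjacent i σ σ′ ∧ σ′ ⊆ᵇ ρ when isFaceOfDim X i σ′
                 ≡⟨ when-when 1 _ (isFaceOfDim X i σ′) ⟩
               1 when isFaceOfDim X i σ′ ∧ adjacent i σ σ′ ∧ σ′ ⊆ᵇ ρ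
                 ≡⟨ cong (1 when_) (neighbour⇔overlap i σ σ′ ρ σ∈X[i] (isFace⇒face d ρ ρ∈X[d]) σ⊆ρ) ⟩
               1 when σ′ ⊆ᵇ ρ ∧ (∣ σ ∩ σ′ ∣ ≡ᵇ i) ∧ (∣ σ′ ─ σ ∣ ≡ᵇ 1) ∎) ⟩
        ∑[ σ′ ] (1 when σ′ ⊆ᵇ ρ ∧ (∣ σ ∩ σ′ ∣ ≡ᵇ i) ∧ (∣ σ′ ─ σ ∣ ≡ᵇ 1))
          ≡⟨ ∑-⊆-overlap σ ρ σ⊆ρ i 1 ⟩
        (∣ σ ∣ C i) * (∣ ρ ─ σ ∣ C 1)
          ≡⟨ cong₂ _*_ (cong (_C i) ∣σ∣≡1+i) (nC1≡n ∣ ρ ─ σ ∣) ⟩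
        (suc i C i) * ∣ ρ ─ σ ∣
          ≡⟨ cong₂ _*_ ([1+n]Cn≡1+n i) (trans (p⊆ᵇq⇒∣q─p∣≡∣q∣∸∣p∣ σ ρ σ⊆ρ)
                                            (cong₂ _∸_ (isFace⇒size d ρ ρ∈X[d]) ∣σ∣≡1+i)) ⟩
        suc i * (d ∸ i) ∎
        where
        open ≡-Reasoning
        ∣σ∣≡1+i = isFace⇒size i σ σ∈X[i]

      degG-iGraph : ∀ i σ → isFaceOfDim X i σ ≡ true → degG (iGraph X d i) σ ≡ suc i * (d ∸ i) * deg X d σ
      degG-iGraph i σ σ∈X[i] = begin
        degG (iGraph X d i) σ
          ≡⟨ sumOver-filterᵇ (isFaceOfDim X i) (allSubsets n) _ ⟩
        ∑[ σ′ ] (deg X d (σ ∪ σ′) when adjacent i σ σ′ when isFaceOfDim X i σ′)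
          ≡⟨ sumOver-cong (allSubsets n) (λ σ′ → trans (cong (λ x → x when adjacent i σ σ′ when isFaceOfDim X i σ′) (deg≡∑ (σ ∪ σ′)))
               (trans (cong (_when isFaceOfDim X i σ′) (when-sumOver (adjacent i σ σ′) (allSubsets n) _))
                      (when-sumOver (isFaceOfDim X i σ′) (allSubsets n) _))) ⟩
        ∑[ σ′ ] ∑[ ρ ] term ρ σ′
          ≡⟨ sumOver-comm (allSubsets n) (allSubsets n) (λ σ′ ρ → term ρ σ′) ⟩
        ∑[ ρ ] ∑[ σ′ ] term ρ σ′
          ≡⟨ sumOver-cong (allSubsets n) (λ ρ → adjacent-within i σ ρ σ∈X[i]) ⟩
        ∑[ ρ ] (c when isFaceOfDim X d ρ ∧ σ ⊆ᵇ ρ)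
          ≡⟨ sumOver-cong (allSubsets n) (λ ρ → when≡*1when c (isFaceOfDim X d ρ ∧ σ ⊆ᵇ ρ)) ⟩
        ∑[ ρ ] (c * (1 when isFaceOfDim X d ρ ∧ σ ⊆ᵇ ρ))
          ≡⟨ *-distribˡ-sumOver c (allSubsets n) _ ⟨
        c * ∑[ ρ ] (1 when isFaceOfDim X d ρ ∧ σ ⊆ᵇ ρ)
          ≡⟨ cong (c *_) (deg≡∑ σ) ⟨
        c * deg X d σ ∎
        where
        open ≡-Reasoning
        c = suc i * (d ∸ i)
        term : Subset n → Subset n → ℕ
        term ρ σ′ = 1 when isFaceOfDim X d ρ ∧ (σ ∪ σ′) ⊆ᵇ ρ when adjacent i σ σ′ when isFaceOfDim X i σ′

      vol-iGraph : ∀ i P → vol (iGraph X d i) P ≡ suc i * (d ∸ i) * sumOver (filterᵇ P (faces X i)) (deg X d)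
      vol-iGraph i P = begin
        sumOver (filterᵇ P (faces X i)) (degG (iGraph X d i))
          ≡⟨ sumOver-cong-∈ (filterᵇ P (faces X i)) (λ σ∈ → degG-iGraph i _ (isFace σ∈)) ⟩
        sumOver (filterᵇ P (faces X i)) (λ σ → suc i * (d ∸ i) * deg X d σ)
          ≡⟨ *-distribˡ-sumOver (suc i * (d ∸ i)) (filterᵇ P (faces X i)) (deg X d) ⟨
        suc i * (d ∸ i) * sumOver (filterᵇ P (faces X i)) (deg X d) ∎
        where
        open ≡-Reasoning
        isFace : ∀ {σ} → σ ∈ filterᵇ P (faces X i) → isFaceOfDim X i σ ≡ true
        isFace σ∈ = T⇒≡true (proj₂ (∈-filter⁻ (T? ∘ isFaceOfDim X i) {xs = allSubsets n} (proj₁ (∈-filter⁻ (T? ∘ P) σ∈))))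

      module _ (i : ℕ) (S : Subset n → Bool) where

        W : Subset n → Bool
        W σ = isFaceOfDim X i σ ∧ S σ

        deg-W deg-ψW : ℕ
        deg-W = sumOver (filterᵇ S (faces X i)) (deg X d)
        deg-ψW = sumOver (filterᵇ (ψ X i W) (faces X (suc i))) (deg X d)

        deg[i+1] : Subset n → ℕ
        deg[i+1] τ = deg X d τ when isFaceOfDim X (suc i) τ

        facetIn facetOut : Subset n → Subset n → Bool
        facetIn  τ σ = isFaceOfDim X i σ ∧ (W σ ∧ σ ⊆ᵇ τ)
        facetOut τ σ = isFaceOfDim X i σ ∧ (not (W σ) ∧ σ ⊆ᵇ τ)

        #facetsIn #facetsOut : Subset n → ℕ
        #facetsIn  τ = ∑[ σ ] (1 when facetIn τ σ)
        #facetsOut τ = ∑[ σ ] (1 when facetOut τ σ)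

        only-union-contributes : ∀ σ σ′ → σ ≢ σ′ → isFaceOfDim X i σ ≡ true → isFaceOfDim X i σ′ ≡ true → ∀ τ →
          deg[i+1] τ * (1 when σ′ ⊆ᵇ τ when σ ⊆ᵇ τ) ≡ deg[i+1] τ * (1 when σ′ ⊆ᵇ τ when σ ⊆ᵇ τ) when τ ≟S (σ ∪ σ′)
        only-union-contributes σ σ′ σ≢σ′ σ∈X[i] σ′∈X[i] τ with τ ≟S (σ ∪ σ′) in τ≟∪
        ... | true = refl
        ... | false with isFaceOfDim X (suc i) τ in τ∈X[i+1] | σ ⊆ᵇ τ in σ⊆τ | σ′ ⊆ᵇ τ in σ′⊆τ
        ...   | false | _     | _     = refl
        ...   | true  | false | _     = ℕₚ.*-zeroʳ (deg X d τ)
        ...   | true  | true  | false = ℕₚ.*-zeroʳ (deg X d τ)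
        ...   | true  | true  | true  = contradiction (trans (sym (≡⇒≟S-true τ (σ ∪ σ′) (sym ∪≡τ))) τ≟∪) λ ()
          where
          ∪≡τ : σ ∪ σ′ ≡ τ
          ∪≡τ = distinct-⊆ᵇ⇒∪≡ i σ σ′ τ (isFace⇒size i σ σ∈X[i]) (isFace⇒size i σ′ σ′∈X[i])
                  (isFace⇒size (suc i) τ τ∈X[i+1]) σ≢σ′ σ⊆τ σ′⊆τ

        -- An edge between σ ∈ S and σ′ ∉ S is charged to the unique (i+1)-face σ ∪ σ′ containing both.
        crossing-edges : ∀ σ σ′ →
          Multigraph.mult (iGraph X d i) σ σ′ when not (S σ′) when isFaceOfDim X i σ′ when S σ when isFaceOfDim X i σ
            ≡ ∑[ τ ] (deg[i+1] τ * (1 when facetOut τ σ′ when facetIn τ σ))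
        crossing-edges σ σ′ with isFaceOfDim X i σ in σ∈X[i] | S σ in Sσ | isFaceOfDim X i σ′ in σ′∈X[i] | S σ′ in Sσ′
        ... | false | _     | _     | _     = sym (sumOver-≡0 (allSubsets n) (λ τ → ℕₚ.*-zeroʳ (deg[i+1] τ)))
        ... | true  | false | _     | _     = sym (sumOver-≡0 (allSubsets n) (λ τ → ℕₚ.*-zeroʳ (deg[i+1] τ)))
        ... | true  | true  | false | _     = sym (sumOver-≡0 (allSubsets n) (λ τ →
          trans (cong (deg[i+1] τ *_) (0-when (σ ⊆ᵇ τ))) (ℕₚ.*-zeroʳ (deg[i+1] τ))))
        ... | true  | true  | true  | true  = sym (sumOver-≡0 (allSubsets n) (λ τ →
          trans (cong (deg[i+1] τ *_) (0-when (σ ⊆ᵇ τ))) (ℕₚ.*-zeroʳ (deg[i+1] τ))))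
        ... | true  | true  | true  | false = begin
          deg X d (σ ∪ σ′) when adjacent i σ σ′
            ≡⟨ cong (λ b → deg X d (σ ∪ σ′) when not b ∧ isFaceOfDim X (suc i) (σ ∪ σ′)) (≢⇒≟S-false σ σ′ σ≢σ′) ⟩
          deg[i+1] (σ ∪ σ′)
            ≡⟨ ℕₚ.*-identityʳ _ ⟨
          deg[i+1] (σ ∪ σ′) * 1
            ≡⟨ cong (deg[i+1] (σ ∪ σ′) *_) (cong₂ (λ b c → 1 when c when b) (⊆ᵇ-∪ˡ σ σ′) (⊆ᵇ-∪ʳ σ σ′)) ⟨
          deg[i+1] (σ ∪ σ′) * (1 when σ′ ⊆ᵇ (σ ∪ σ′) when σ ⊆ᵇ (σ ∪ σ′))
            ≡⟨ ∑-when-≟S (σ ∪ σ′) (λ τ → deg[i+1] τ * (1 when σ′ ⊆ᵇ τ when σ ⊆ᵇ τ)) ⟨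
          ∑[ τ ] (deg[i+1] τ * (1 when σ′ ⊆ᵇ τ when σ ⊆ᵇ τ) when τ ≟S (σ ∪ σ′))
            ≡⟨ sumOver-cong (allSubsets n) (only-union-contributes σ σ′ σ≢σ′ σ∈X[i] σ′∈X[i]) ⟨
          ∑[ τ ] (deg[i+1] τ * (1 when σ′ ⊆ᵇ τ when σ ⊆ᵇ τ)) ∎
          where
          open ≡-Reasoning
          σ≢σ′ : σ ≢ σ′
          σ≢σ′ σ≡σ′ = contradiction (trans (sym Sσ) (trans (cong S σ≡σ′) Sσ′)) λ ()

        cut≡∑deg[i+1]*facets : cut (iGraph X d i) S ≡ ∑[ τ ] (deg[i+1] τ * (#facetsIn τ * #facetsOut τ))
        cut≡∑deg[i+1]*facets = begin
          cut (iGraph X d i) S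
            ≡⟨ trans (sumOver-filterᵇ S (faces X i) _) (sumOver-filterᵇ (isFaceOfDim X i) (allSubsets n) _) ⟩
          ∑[ σ ] (sumOver (filterᵇ (not ∘ S) (faces X i)) (edges σ) when S σ when isFaceOfDim X i σ)
            ≡⟨ sumOver-cong (allSubsets n) (λ σ → cong (λ x → x when S σ when isFaceOfDim X i σ)
                 (trans (sumOver-filterᵇ (not ∘ S) (faces X i) _) (sumOver-filterᵇ (isFaceOfDim X i) (allSubsets n) _))) ⟩
          ∑[ σ ] (∑[ σ′ ] (edges σ σ′ when not (S σ′) when isFaceOfDim X i σ′) when S σ when isFaceOfDim X i σ)
            ≡⟨ sumOver-cong (allSubsets n) (λ σ → trans (cong (_when isFaceOfDim X i σ) (when-sumOver (S σ) (allSubsets n) _))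
                 (when-sumOver (isFaceOfDim X i σ) (allSubsets n) _)) ⟩
          ∑[ σ ] ∑[ σ′ ] (edges σ σ′ when not (S σ′) when isFaceOfDim X i σ′ when S σ when isFaceOfDim X i σ)
            ≡⟨ sumOver-cong (allSubsets n) (λ σ → sumOver-cong (allSubsets n) (crossing-edges σ)) ⟩
          ∑[ σ ] ∑[ σ′ ] ∑[ τ ] (deg[i+1] τ * (1 when facetOut τ σ′ when facetIn τ σ))
            ≡⟨ sumOver-cong (allSubsets n) (λ σ → sumOver-comm (allSubsets n) (allSubsets n) _) ⟩
          ∑[ σ ] ∑[ τ ] ∑[ σ′ ] (deg[i+1] τ * (1 when facetOut τ σ′ when facetIn τ σ))
            ≡⟨ sumOver-comm (allSubsets n) (allSubsets n) _ ⟩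
          ∑[ τ ] ∑[ σ ] ∑[ σ′ ] (deg[i+1] τ * (1 when facetOut τ σ′ when facetIn τ σ))
            ≡⟨ sumOver-cong (allSubsets n) factor ⟩
          ∑[ τ ] (deg[i+1] τ * (#facetsIn τ * #facetsOut τ)) ∎
          where
          open ≡-Reasoning
          edges : Subset n → Subset n → ℕ
          edges = Multigraph.mult (iGraph X d i)
          factor : ∀ τ → ∑[ σ ] ∑[ σ′ ] (deg[i+1] τ * (1 when facetOut τ σ′ when facetIn τ σ))
                         ≡ deg[i+1] τ * (#facetsIn τ * #facetsOut τ)
          factor τ = begin
            ∑[ σ ] ∑[ σ′ ] (deg[i+1] τ * (1 when facetOut τ σ′ when facetIn τ σ))
              ≡⟨ sumOver-cong (allSubsets n) (λ σ → *-distribˡ-sumOver (deg[i+1] τ) (allSubsets n) _) ⟨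
            ∑[ σ ] (deg[i+1] τ * ∑[ σ′ ] (1 when facetOut τ σ′ when facetIn τ σ))
              ≡⟨ *-distribˡ-sumOver (deg[i+1] τ) (allSubsets n) _ ⟨
            deg[i+1] τ * ∑[ σ ] ∑[ σ′ ] (1 when facetOut τ σ′ when facetIn τ σ)
              ≡⟨ cong (deg[i+1] τ *_) (sumOver-when-sumOver (allSubsets n) (allSubsets n) (facetIn τ) ((1 when_) ∘ facetOut τ)) ⟩
            deg[i+1] τ * (#facetsIn τ * #facetsOut τ) ∎
        #facetsIn+#facetsOut : ∀ τ → isFaceOfDim X (suc i) τ ≡ true → #facetsIn τ + #facetsOut τ ≡ suc (suc i)
        #facetsIn+#facetsOut τ τ∈X[i+1] = begin
          #facetsIn τ + #facetsOut τ
            ≡⟨ sumOver-+ (allSubsets n) _ _ ⟨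
          ∑[ σ ] ((1 when facetIn τ σ) + (1 when facetOut τ σ))
            ≡⟨ sumOver-cong (allSubsets n) in-or-out ⟩
          ∑[ σ ] (1 when isFaceOfDim X i σ ∧ σ ⊆ᵇ τ)
            ≡⟨ sumOver-cong (allSubsets n) (λ σ → cong (1 when_) (isFace∧⊆ᵇ i σ τ (isFace⇒face (suc i) τ τ∈X[i+1]))) ⟩
          ∑[ σ ] (1 when σ ⊆ᵇ τ ∧ (∣ σ ∣ ≡ᵇ suc i))
            ≡⟨ ∑-⊆-size τ (suc i) ⟩
          ∣ τ ∣ C suc i
            ≡⟨ cong (_C suc i) (isFace⇒size (suc i) τ τ∈X[i+1]) ⟩
          suc (suc i) C suc i
            ≡⟨ [1+n]Cn≡1+n (suc i) ⟩
          suc (suc i) ∎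
          where
          open ≡-Reasoning
          in-or-out : ∀ σ → (1 when facetIn τ σ) + (1 when facetOut τ σ) ≡ 1 when isFaceOfDim X i σ ∧ σ ⊆ᵇ τ
          in-or-out σ with isFaceOfDim X i σ | S σ
          ... | false | _     = refl
          ... | true  | true  = ℕₚ.+-identityʳ _
          ... | true  | false = refl

        cut≥ : suc i * deg-ψW ≤ cut (iGraph X d i) S
        cut≥ = begin
          suc i * deg-ψW
            ≡⟨ cong (suc i *_) (trans (sumOver-filterᵇ (ψ X i W) (faces X (suc i)) _)
                                      (sumOver-filterᵇ (isFaceOfDim X (suc i)) (allSubsets n) _)) ⟩
          suc i * ∑[ τ ] (deg X d τ when ψ X i W τ when isFaceOfDim X (suc i) τ)
            ≡⟨ *-distribˡ-sumOver (suc i) (allSubsets n) _ ⟩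
          ∑[ τ ] (suc i * (deg X d τ when ψ X i W τ when isFaceOfDim X (suc i) τ))
            ≤⟨ sumOver-mono (allSubsets n) (λ τ → boundary-term τ refl refl) ⟩
          ∑[ τ ] (deg[i+1] τ * (#facetsIn τ * #facetsOut τ))
            ≡⟨ cut≡∑deg[i+1]*facets ⟨
          cut (iGraph X d i) S ∎
          where
          open ℕₚ.≤-Reasoning
          boundary-term : ∀ τ {p f} → ψ X i W τ ≡ p → isFaceOfDim X (suc i) τ ≡ f →
            suc i * (deg X d τ when p when f) ≤ (deg X d τ when f) * (#facetsIn τ * #facetsOut τ)
          boundary-term τ {p} {false} _ _ = ℕₚ.≤-reflexive (ℕₚ.*-zeroʳ (suc i))
          boundary-term τ {false} {true} _ _ = subst (_≤ deg X d τ * (#facetsIn τ * #facetsOut τ)) (sym (ℕₚ.*-zeroʳ (suc i))) z≤n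
          boundary-term τ {true} {true} ψτ τ∈X[i+1] = begin
            suc i * deg X d τ                      ≡⟨ ℕₚ.*-comm (suc i) (deg X d τ) ⟩
            deg X d τ * suc i                      ≤⟨ ℕₚ.*-monoʳ-≤ (deg X d τ) (k+l≡2+j⇒1+j≤k*l i _ _ in≥1 out≥1
                                                        (#facetsIn+#facetsOut τ τ∈X[i+1])) ⟩
            deg X d τ * (#facetsIn τ * #facetsOut τ) ∎
            where
            some-in-and-out = proj₂ (∧≡true⇒× {isFaceOfDim X (suc i) τ} ψτ)
            in≥1 = any-filterᵇ⇒1≤sumOver (isFaceOfDim X i) (λ σ → W σ ∧ σ ⊆ᵇ τ) (allSubsets n)
                     (proj₁ (∧≡true⇒× some-in-and-out))
            out≥1 = any-filterᵇ⇒1≤sumOver (isFaceOfDim X i) (λ σ → not (W σ) ∧ σ ⊆ᵇ τ) (allSubsets n)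
                      (proj₂ (∧≡true⇒× some-in-and-out))

        W⊆X[i] : SubsetOfFaces X i W
        W⊆X[i] σ σ∈W = proj₁ (Equivalence.to Boolₚ.T-∧ σ∈W)

        colorful-expansion : ∀ {ε} → ColorfulExpander X d ε → i < d →
          (pos : 0ℚ ℚ.< frac deg-W (deg-X i)) → frac deg-W (deg-X i) ℚ.≤ ½ →
          ε ℚ.≤ ℚ._÷_ (frac deg-ψW (deg-X (suc i))) (frac deg-W (deg-X i)) {{ℚ.>-nonZero pos}}
        colorful-expansion (_ , expands) i<d
          rewrite sym (filterᵇ-∧-filterᵇ (isFaceOfDim X i) S (allSubsets n)) = expands i i<d W W⊆X[i]

        pure⇒1≤deg-W : IsPure X d → ∀ {v} → v ∈ faces X i → T (S v) → 1 ≤ deg-W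
        pure⇒1≤deg-W pure {v} v∈X[i] Sv = ℕₚ.≤-trans (pure⇒1≤deg pure v (isFace⇒face i v v∈X[i]′))
          (≤-sumOver (filterᵇ S (faces X i)) (deg X d) (∈-filter⁺ (T? ∘ S) v∈X[i] Sv))
          where v∈X[i]′ = T⇒≡true (proj₂ (∈-filter⁻ (T? ∘ isFaceOfDim X i) {xs = allSubsets n} v∈X[i]))

        half-volume⇒half-deg-W : i < d → 2 * vol (iGraph X d i) S ≤ vol (iGraph X d i) (λ _ → true) →
          2 * deg-W ≤ deg-X i
        half-volume⇒half-deg-W i<d 2vol≤vol =
          ℕₚ.*-cancelˡ-≤ c {{ℕ.>-nonZero (ℕₚ.*-mono-≤ (s≤s (z≤n {i})) (ℕₚ.m<n⇒0<n∸m i<d))}} (subst₂ _≤_ 2vol≡ vol≡ 2vol≤vol)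
          where
          c = suc i * (d ∸ i)
          2vol≡ : 2 * vol (iGraph X d i) S ≡ c * (2 * deg-W)
          2vol≡ = trans (cong (2 *_) (vol-iGraph i S)) (solve 2 (λ c A → con 2 :* (c :* A) := c :* (con 2 :* A)) refl c deg-W)
          vol≡ : vol (iGraph X d i) (λ _ → true) ≡ c * deg-X i
          vol≡ = trans (vol-iGraph i (λ _ → true))
                       (cong (λ xs → c * sumOver xs (deg X d))
                             (filter-all (T? ∘ λ _ → true) (All.universal (λ _ → tt) (faces X i))))

  toℚᵘ-frac : ∀ a b → ℚ.toℚᵘ (frac a (suc b)) ℚᵘ.≃ ℚᵘ.mkℚᵘ (ℤ.+ a) b
  toℚᵘ-frac a b = ℚₚ.toℚᵘ-fromℚᵘ (ℚᵘ.mkℚᵘ (ℤ.+ a) b)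

  +a*+b≡+[a*b] : ∀ a b → ℤ.+ a ℤ.* ℤ.+ b ≡ ℤ.+ (a * b)
  +a*+b≡+[a*b] a b = ℤₚ.+◃n≡+n (a * b)

  0<frac : ∀ a b → 0ℚ ℚ.< frac (suc a) (suc b)
  0<frac a b = ℚₚ.toℚᵘ-cancel-< (ℚᵘₚ.<-respʳ-≃ (ℚᵘₚ.≃-sym (toℚᵘ-frac (suc a) b))
    (ℚᵘ.*<* (subst₂ ℤ._<_ (sym (+a*+b≡+[a*b] 0 (suc b))) (sym (+a*+b≡+[a*b] (suc a) 1)) (ℤ.+<+ (s≤s z≤n)))))

  frac-mono : ∀ a b c e → a * suc e ≤ c * suc b → frac a (suc b) ℚ.≤ frac c (suc e)
  frac-mono a b c e a[1+e]≤c[1+b] = ℚₚ.toℚᵘ-cancel-≤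
    (ℚᵘₚ.≤-respʳ-≃ (ℚᵘₚ.≃-sym (toℚᵘ-frac c e)) (ℚᵘₚ.≤-respˡ-≃ (ℚᵘₚ.≃-sym (toℚᵘ-frac a b))
      (ℚᵘ.*≤* (subst₂ ℤ._≤_ (sym (+a*+b≡+[a*b] a (suc e))) (sym (+a*+b≡+[a*b] c (suc b))) (ℤ.+≤+ a[1+e]≤c[1+b])))))

  frac*frac-mono : ∀ a b c e f g h k → a * c * (suc g * suc k) ≤ f * h * (suc b * suc e) →
    frac a (suc b) ℚ.* frac c (suc e) ℚ.≤ frac f (suc g) ℚ.* frac h (suc k)
  frac*frac-mono a b c e f g h k cross = ℚₚ.toℚᵘ-cancel-≤
    (ℚᵘₚ.≤-respʳ-≃ (ℚᵘₚ.≃-sym (toℚᵘ-product f g h k)) (ℚᵘₚ.≤-respˡ-≃ (ℚᵘₚ.≃-sym (toℚᵘ-product a b c e))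
      (ℚᵘ.*≤* (subst₂ ℤ._≤_ (sym (+[x*y]*+z a c (suc g * suc k))) (sym (+[x*y]*+z f h (suc b * suc e))) (ℤ.+≤+ cross)))))
    where
    toℚᵘ-product : ∀ x y z w → ℚ.toℚᵘ (frac x (suc y) ℚ.* frac z (suc w)) ℚᵘ.≃ ℚᵘ.mkℚᵘ (ℤ.+ x) y ℚᵘ.* ℚᵘ.mkℚᵘ (ℤ.+ z) w
    toℚᵘ-product x y z w = ℚᵘₚ.≃-trans (ℚₚ.toℚᵘ-homo-* (frac x (suc y)) (frac z (suc w)))
                                       (ℚᵘₚ.*-cong (toℚᵘ-frac x y) (toℚᵘ-frac z w))
    +[x*y]*+z : ∀ x y z → ℤ.+ x ℤ.* ℤ.+ y ℤ.* ℤ.+ z ≡ ℤ.+ (x * y * z)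
    +[x*y]*+z x y z = trans (cong (ℤ._* ℤ.+ z) (+a*+b≡+[a*b] x y)) (+a*+b≡+[a*b] (x * y) z)

  ≤÷⇒*≤ : (ε x y q r : ℚ) .{{_ : ℚ.NonZero y}} → ℚ.Positive y → ℚ.NonNegative q →
    ε ℚ.≤ x ℚ.÷ y → x ℚ.* q ℚ.≤ r ℚ.* y → ε ℚ.* q ℚ.≤ r
  ≤÷⇒*≤ ε x y q r y>0 q≥0 ε≤x/y xq≤ry =
    ℚₚ.≤-trans (ℚₚ.*-monoʳ-≤-nonNeg q {{q≥0}} ε≤x/y)
               (ℚₚ.*-cancelʳ-≤-pos y {{y>0}} (subst (ℚ._≤ r ℚ.* y) (sym x/y*q*y≡x*q) xq≤ry))
    where
    open ≡-Reasoning
    x/y*q*y≡x*q : x ℚ.÷ y ℚ.* q ℚ.* y ≡ x ℚ.* q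
    x/y*q*y≡x*q = begin
      x ℚ.* ℚ.1/ y ℚ.* q ℚ.* y      ≡⟨ ℚₚ.*-assoc (x ℚ.* ℚ.1/ y) q y ⟩
      x ℚ.* ℚ.1/ y ℚ.* (q ℚ.* y)    ≡⟨ cong (x ℚ.* ℚ.1/ y ℚ.*_) (ℚₚ.*-comm q y) ⟩
      x ℚ.* ℚ.1/ y ℚ.* (y ℚ.* q)    ≡⟨ ℚₚ.*-assoc x (ℚ.1/ y) (y ℚ.* q) ⟩
      x ℚ.* (ℚ.1/ y ℚ.* (y ℚ.* q))  ≡⟨ cong (x ℚ.*_) (ℚₚ.*-assoc (ℚ.1/ y) y q) ⟨
      x ℚ.* (ℚ.1/ y ℚ.* y ℚ.* q)    ≡⟨ cong (λ z → x ℚ.* (z ℚ.* q)) (ℚₚ.*-inverseˡ y) ⟩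
      x ℚ.* (ℚ.1ℚ ℚ.* q)            ≡⟨ cong (x ℚ.*_) (ℚₚ.*-identityˡ q) ⟩
      x ℚ.* q                       ∎

  conductance-bound : (ε : ℚ) (A D₀ D₁ B E j t : ℕ) → 1 ≤ A → 1 ≤ t →
    2 * A ≤ D₀ → D₀ * t ≡ D₁ * suc (suc j) → suc j * B ≤ E →
    ((pos : 0ℚ ℚ.< frac A D₀) → frac A D₀ ℚ.≤ ½ → ε ℚ.≤ ℚ._÷_ (frac B D₁) (frac A D₀) {{ℚ.>-nonZero pos}}) →
    ε ℚ.* frac 1 (suc (suc j)) ℚ.≤ frac E (suc j * t * A)
  conductance-bound ε (suc a) (suc D₀) zero    B E j (suc t) _ _ _ () _ _
  conductance-bound ε (suc a) (suc D₀) (suc D₁) B E j (suc t) _ _ 2A≤D₀ ratio [1+j]B≤E expands =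
    ≤÷⇒*≤ ε (frac B (suc D₁)) (frac (suc a) (suc D₀)) (frac 1 (suc (suc j))) (frac E (suc j * suc t * suc a))
      {{ℚ.>-nonZero ‖W‖>0}} (ℚ.positive ‖W‖>0) (ℚₚ.normalize-nonNeg 1 (suc (suc j)))
      (expands ‖W‖>0 ‖W‖≤½) (frac*frac-mono B D₁ 1 (suc j) E _ (suc a) D₀ cross)
    where
    ‖W‖>0 = 0<frac a D₀
    ‖W‖≤½ : frac (suc a) (suc D₀) ℚ.≤ ½
    ‖W‖≤½ = frac-mono (suc a) D₀ 1 1 (subst₂ _≤_ (ℕₚ.*-comm 2 (suc a)) (sym (ℕₚ.*-identityˡ (suc D₀))) 2A≤D₀)
    cross : B * 1 * (suc j * suc t * suc a * suc D₀) ≤ E * suc a * (suc D₁ * suc (suc j))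
    cross = begin
      B * 1 * (suc j * suc t * suc a * suc D₀)     ≡⟨ solve 5 (λ b j t a d → b :* con 1 :* ((con 1 :+ j) :* t :* a :* d)
                                                              := ((con 1 :+ j) :* b) :* (a :* (d :* t))) refl B j (suc t) (suc a) (suc D₀) ⟩
      suc j * B * (suc a * (suc D₀ * suc t))       ≤⟨ ℕₚ.*-monoˡ-≤ (suc a * (suc D₀ * suc t)) [1+j]B≤E ⟩
      E * (suc a * (suc D₀ * suc t))               ≡⟨ cong (λ x → E * (suc a * x)) ratio ⟩
      E * (suc a * (suc D₁ * suc (suc j)))         ≡⟨ ℕₚ.*-assoc E (suc a) _ ⟨
      E * suc a * (suc D₁ * suc (suc j))           ∎
      where open ℕₚ.≤-Reasoning

open import Data.Nat using (ℕ; suc; _<_; _∸_)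
open import Data.Nat.Properties using (m<n⇒0<n∸m)
open import Data.Integer using (+_)
open import Data.Rational using (ℚ; _/_; _*_; _≤_)
open import Data.Product using (_,_)
open import Relation.Binary.PropositionalEquality using (subst; sym)

lemma3p4 : {n : ℕ} (X : SimplicialComplex n) (d : ℕ) (ε : ℚ) →
    IsDimension X d → IsPure X d → ColorfulExpander X d ε →
    (i : ℕ) → i < d →
    ConductanceAtLeast (iGraph X d i) (ε * ((+ 1) / suc (suc i)))
lemma3p4 X d ε _ pure expander i i<d S (v , v∈X[i] , Sv) 2vol≤vol =
  subst (λ V → ε * ((+ 1) / suc (suc i)) ≤ frac (cut (iGraph X d i) S) V) (sym (vol-iGraph X d i S))
    (conductance-bound ε (deg-W X d i S) (deg-X X d i) (deg-X X d (suc i)) (deg-ψW X d i S)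
      (cut (iGraph X d i) S) i (d ∸ i)
      (pure⇒1≤deg-W X d i S pure v∈X[i] Sv)
      (m<n⇒0<n∸m i<d)
      (half-volume⇒half-deg-W X d i S i<d 2vol≤vol)
      (deg-X-ratio X d i)
      (cut≥ X d i S)
      (colorful-expansion X d i S expander i<d))
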